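{- Let $n,k,t$ be positive integers with $n\ge 2k+2$ and $k\ge t+1$. For positive integers $x$ let $$h(n,k,t,x)=\genfrac{[}{]}{0pt}{}{x}{t}_q\,\genfrac{[}{]}{0pt}{}{k-t+1}{1}_q^{\,x-t}\,\genfrac{[}{]}{0pt}{}{n-x}{k-x}_q.$$ Then $h(n,k,t,x)\ge h(n,k,t,x+1)$ for every $x\in\{t,t+1,\dots,k\}$.
   Context: $q$ is a prime power. The Gaussian binomial coefficient is $\genfrac{[}{]}{0pt}{}{m}{i}_q=\prod_{0\le j<i}\frac{q^{m-j}-1}{q^{i-j}-1}$, with $\genfrac{[}{]}{0pt}{}{m}{0}_q=1$ and $\genfrac{[}{]}{0pt}{}{m}{c}_q=0$ for negative $c$. -}

module Defs where

open import Data.Nat using (ℕ; zero; suc; _+_; _*_; _∸_; _^_; _/_; _≤_; _<_)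
open import Data.Nat.Primality using (Prime)
open import Data.Integer using (ℤ; +_; -[1+_])
open import Data.Product using (Σ; ∃; _×_)
open import Relation.Binary.PropositionalEquality using (_≡_)

IsPrimePower : ℕ → Set
IsPrimePower q = Σ ℕ λ p → Σ ℕ λ e → Prime p × 1 ≤ e × q ≡ p ^ e

qNum : ℕ → ℕ → ℕ → ℕ
qNum q m zero    = 1
qNum q m (suc i) = qNum q m i * (q ^ (m ∸ i) ∸ 1)

qDen : ℕ → ℕ → ℕ
qDen q zero    = 1
qDen q (suc i) = qDen q i * (q ^ suc i ∸ 1)

-- Gaussian binomial [m choose i]_q for natural i, as the paper's product of
-- ratios (the quotient is exact; the division is ℕ division).
-- For i > m the numerator contains the factor q^0 - 1 = 0, giving 0.
-- ℕ division with divisor 0 mapped to 1 (the denominator is positive for q ≥ 2)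
divPos : ℕ → ℕ → ℕ
divPos a zero    = a
divPos a (suc d) = a / suc d

gauss : ℕ → ℕ → ℕ → ℕ
gauss q m i = divPos (qNum q m i) (qDen q i)

gaussℤ : ℕ → ℕ → ℤ → ℕ
gaussℤ q m (+ c)     = gauss q m c
gaussℤ q m -[1+ c ]  = 0

h : ℕ → ℕ → ℕ → ℕ → ℕ → ℕ
h q n k t x = gauss q x t * (gauss q (k ∸ t + 1) 1 ^ (x ∸ t))
              * gaussℤ q (n ∸ x) (k Data.Integer.⊖ x)

{-# OPTIONS --safe #-}
-- Write [m] = q^m - 1. The Gaussian binomials are exact quotients (by the
-- q-Pascal rule), so for t ≤ x < k the ratio h(x+1)/h(x) is
--   [x+1] [k-t+1] [k-x] / ([x+1-t] [1] [n-x]).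
-- Since [x+1] ≤ q^(t+1) [x+1-t] and q^(t+1) [k-t+1] [k-x] ≤ [2k+2-x] ≤ [n-x]
-- (this is where n ≥ 2k+2 enters), the ratio is at most 1. At x = k the
-- factor [n-k-1 choose -1] of h(k+1) vanishes.
module Submission where

open import Defs
open import Data.Nat
  using (ℕ; zero; suc; _+_; _*_; _∸_; _^_; _≤_; _≥_; _<_; z≤n; s≤s; NonZero; NonTrivial; >-nonZero
        ; n>1⇒nonTrivial; nonTrivial⇒nonZero; nonTrivial⇒n>1)
open import Data.Nat.Properties
open import Data.Nat.DivMod using (m*n/n≡m)
open import Data.Nat.Primality using (prime⇒nonTrivial)
open import Data.Nat.Tactic.RingSolver using (solve-∀)
open import Data.Integer.Properties using (⊖-≥; ⊖-<)
open import Data.Product using (_,_)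
open import Data.Sum using (inj₁; inj₂)
open import Relation.Binary.PropositionalEquality
open import Relation.Nullary using (yes; no)

m∸n≡1+m∸[1+n] : ∀ {m n} → n < m → m ∸ n ≡ suc (m ∸ suc n)
m∸n≡1+m∸[1+n] {suc m} (s≤s n≤m) = +-∸-assoc 1 n≤m

primePower⇒nonTrivial : ∀ {q} → IsPrimePower q → NonTrivial q
primePower⇒nonTrivial (p , suc e , p-prime , _ , refl) =
  n>1⇒nonTrivial (≤-trans (nonTrivial⇒n>1 p) (m≤m*n p (p ^ e) {{m^n≢0 p e}}))
  where instance
    p≢0 : NonZero p
    p≢0 = nonTrivial⇒nonZero p {{prime⇒nonTrivial p-prime}}

module QAnalogue (q : ℕ) where

  ⟦_⟧ : ℕ → ℕ
  ⟦ m ⟧ = q ^ m ∸ 1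

  qNum-suc : ∀ m i → qNum q (suc m) (suc i) ≡ ⟦ suc m ⟧ * qNum q m i
  qNum-suc m zero    = trans (*-identityˡ _) (sym (*-identityʳ _))
  qNum-suc m (suc i) = begin
    qNum q (suc m) (suc i) * ⟦ m ∸ i ⟧   ≡⟨ cong (_* ⟦ m ∸ i ⟧) (qNum-suc m i) ⟩
    ⟦ suc m ⟧ * qNum q m i * ⟦ m ∸ i ⟧   ≡⟨ *-assoc ⟦ suc m ⟧ _ _ ⟩
    ⟦ suc m ⟧ * qNum q m (suc i)         ∎
    where open ≡-Reasoning

  qNum-vanishes : ∀ {m i} → m < i → qNum q m i ≡ 0
  qNum-vanishes {m} {suc i} (s≤s m≤i) with m≤n⇒m<n∨m≡n m≤i
  ... | inj₁ m<i   rewrite qNum-vanishes m<i = refl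
  ... | inj₂ refl rewrite n∸n≡0 m = *-zeroʳ (qNum q m m)

  h-explicit : ∀ n k t {x} → x ≤ k →
               h q n k t x ≡ gauss q x t * gauss q (k ∸ t + 1) 1 ^ (x ∸ t) * gauss q (n ∸ x) (k ∸ x)
  h-explicit n k t x≤k rewrite ⊖-≥ x≤k = refl

  h-vanishes : ∀ n k t {x} → k < x → h q n k t x ≡ 0
  h-vanishes n k t {x} k<x rewrite ⊖-< k<x | m∸n≡1+m∸[1+n] k<x =
    *-zeroʳ (gauss q x t * gauss q (k ∸ t + 1) 1 ^ (x ∸ t))

  module _ .{{_ : NonZero q}} where

    ⟦m⟧+1≡q^m : ∀ m → ⟦ m ⟧ + 1 ≡ q ^ m
    ⟦m⟧+1≡q^m m = m∸n+n≡m (m^n>0 q m)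

    ⟦m⟧<q^m : ∀ m → ⟦ m ⟧ < q ^ m
    ⟦m⟧<q^m m = subst (⟦ m ⟧ <_) (trans (+-comm 1 ⟦ m ⟧) (⟦m⟧+1≡q^m m)) ≤-refl

    ⟦⟧-mono-≤ : ∀ {m n} → m ≤ n → ⟦ m ⟧ ≤ ⟦ n ⟧
    ⟦⟧-mono-≤ m≤n = ∸-monoˡ-≤ 1 (^-monoʳ-≤ q m≤n)

    ⟦m+n⟧≡⟦m⟧+q^m*⟦n⟧ : ∀ m n → ⟦ m + n ⟧ ≡ ⟦ m ⟧ + q ^ m * ⟦ n ⟧
    ⟦m+n⟧≡⟦m⟧+q^m*⟦n⟧ m n = +-cancelʳ-≡ 1 _ _ (begin
      ⟦ m + n ⟧ + 1                   ≡⟨ ⟦m⟧+1≡q^m (m + n) ⟩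
      q ^ (m + n)                     ≡⟨ ^-distribˡ-+-* q m n ⟩
      q ^ m * q ^ n                   ≡⟨ cong (q ^ m *_) (sym (⟦m⟧+1≡q^m n)) ⟩
      q ^ m * (⟦ n ⟧ + 1)             ≡⟨ *-distribˡ-+ (q ^ m) ⟦ n ⟧ 1 ⟩
      q ^ m * ⟦ n ⟧ + q ^ m * 1       ≡⟨ cong (q ^ m * ⟦ n ⟧ +_) (*-identityʳ (q ^ m)) ⟩
      q ^ m * ⟦ n ⟧ + q ^ m           ≡⟨ cong (q ^ m * ⟦ n ⟧ +_) (⟦m⟧+1≡q^m m) ⟨
      q ^ m * ⟦ n ⟧ + (⟦ m ⟧ + 1)     ≡⟨ rearrange (q ^ m * ⟦ n ⟧) ⟦ m ⟧ ⟩
      ⟦ m ⟧ + q ^ m * ⟦ n ⟧ + 1       ∎)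
      where
      open ≡-Reasoning
      rearrange : ∀ b a → b + (a + 1) ≡ a + b + 1
      rearrange = solve-∀

    q^m*⟦n⟧*⟦o⟧≤⟦m+n+o⟧ : ∀ m n o → q ^ m * ⟦ n ⟧ * ⟦ o ⟧ ≤ ⟦ m + n + o ⟧
    q^m*⟦n⟧*⟦o⟧≤⟦m+n+o⟧ m n o = ∸-monoˡ-≤ 1 (begin-strict
      q ^ m * ⟦ n ⟧ * ⟦ o ⟧     ≡⟨ *-assoc (q ^ m) ⟦ n ⟧ ⟦ o ⟧ ⟩
      q ^ m * (⟦ n ⟧ * ⟦ o ⟧)   <⟨ *-monoʳ-< (q ^ m) {{m^n≢0 q m}} ⟦n⟧*⟦o⟧<q^n*q^o ⟩
      q ^ m * (q ^ n * q ^ o)   ≡⟨ cong (q ^ m *_) (^-distribˡ-+-* q n o) ⟨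
      q ^ m * q ^ (n + o)       ≡⟨ ^-distribˡ-+-* q m (n + o) ⟨
      q ^ (m + (n + o))         ≡⟨ cong (q ^_) (+-assoc m n o) ⟨
      q ^ (m + n + o)           ∎)
      where
      open ≤-Reasoning
      ⟦n⟧*⟦o⟧<q^n*q^o : ⟦ n ⟧ * ⟦ o ⟧ < q ^ n * q ^ o
      ⟦n⟧*⟦o⟧<q^n*q^o = begin-strict
        ⟦ n ⟧ * ⟦ o ⟧   ≤⟨ *-monoʳ-≤ ⟦ n ⟧ (m∸n≤m (q ^ o) 1) ⟩
        ⟦ n ⟧ * q ^ o   <⟨ *-monoˡ-< (q ^ o) {{m^n≢0 q o}} (⟦m⟧<q^m n) ⟩
        q ^ n * q ^ o   ∎

    pascal : ℕ → ℕ → ℕ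
    pascal m       zero    = 1
    pascal zero    (suc i) = 0
    pascal (suc m) (suc i) = pascal m i + q ^ suc i * pascal m (suc i)

    qNum-pascal : ∀ m i →
                  qNum q m i * ⟦ suc i ⟧ + q ^ suc i * qNum q m (suc i) ≡ qNum q (suc m) (suc i)
    qNum-pascal m i with i ≤? m
    ... | no i≰m
      rewrite qNum-vanishes (≰⇒> i≰m) | qNum-vanishes (s≤s (≰⇒> i≰m)) | *-zeroʳ (q ^ suc i) = refl
    ... | yes i≤m = begin
      qNum q m i * ⟦ suc i ⟧ + q ^ suc i * (qNum q m i * ⟦ m ∸ i ⟧)
        ≡⟨ factor (qNum q m i) ⟦ suc i ⟧ (q ^ suc i) ⟦ m ∸ i ⟧ ⟩
      (⟦ suc i ⟧ + q ^ suc i * ⟦ m ∸ i ⟧) * qNum q m i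
        ≡⟨ cong (_* qNum q m i) (⟦m+n⟧≡⟦m⟧+q^m*⟦n⟧ (suc i) (m ∸ i)) ⟨
      ⟦ suc i + (m ∸ i) ⟧ * qNum q m i
        ≡⟨ cong (λ j → ⟦ suc j ⟧ * qNum q m i) (m+[n∸m]≡n i≤m) ⟩
      ⟦ suc m ⟧ * qNum q m i
        ≡⟨ qNum-suc m i ⟨
      qNum q (suc m) (suc i) ∎
      where
      open ≡-Reasoning
      factor : ∀ N a Q b → N * a + Q * (N * b) ≡ (a + Q * b) * N
      factor = solve-∀

    pascal*qDen≡qNum : ∀ m i → pascal m i * qDen q i ≡ qNum q m i
    pascal*qDen≡qNum m       zero    = refl
    pascal*qDen≡qNum zero    (suc i) = sym (qNum-vanishes {0} {suc i} (s≤s z≤n))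
    pascal*qDen≡qNum (suc m) (suc i) = begin
      (pascal m i + q ^ suc i * pascal m (suc i)) * (qDen q i * ⟦ suc i ⟧)
        ≡⟨ expand (pascal m i) (q ^ suc i) (pascal m (suc i)) (qDen q i) ⟦ suc i ⟧ ⟩
      pascal m i * qDen q i * ⟦ suc i ⟧ + q ^ suc i * (pascal m (suc i) * qDen q (suc i))
        ≡⟨ cong₂ (λ a b → a * ⟦ suc i ⟧ + q ^ suc i * b) (pascal*qDen≡qNum m i) (pascal*qDen≡qNum m (suc i)) ⟩
      qNum q m i * ⟦ suc i ⟧ + q ^ suc i * qNum q m (suc i)
        ≡⟨ qNum-pascal m i ⟩
      qNum q (suc m) (suc i) ∎
      where
      open ≡-Reasoning
      expand : ∀ a Q b d e → (a + Q * b) * (d * e) ≡ a * d * e + Q * (b * (d * e))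
      expand = solve-∀

  module _ .{{_ : NonTrivial q}} where

    private instance
      q≢0 : NonZero q
      q≢0 = nonTrivial⇒nonZero q

    ⟦⟧>0 : ∀ {m} → 0 < m → 0 < ⟦ m ⟧
    ⟦⟧>0 {suc m} _ = m<n⇒0<n∸m (≤-trans (nonTrivial⇒n>1 q) (m≤m*n q (q ^ m) {{m^n≢0 q m}}))

    qDen>0 : ∀ i → 0 < qDen q i
    qDen>0 zero    = s≤s z≤n
    qDen>0 (suc i) = *-mono-≤ (qDen>0 i) (⟦⟧>0 {suc i} (s≤s z≤n))

    gauss*qDen≡qNum : ∀ m i → gauss q m i * qDen q i ≡ qNum q m i
    gauss*qDen≡qNum m i = trans (cong (_* qDen q i) gauss≡pascal) (pascal*qDen≡qNum m i)
      where
      divPos-*-cancelʳ : ∀ a d → 0 < d → divPos (a * d) d ≡ a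
      divPos-*-cancelʳ a (suc d) _ = m*n/n≡m a (suc d)
      gauss≡pascal : gauss q m i ≡ pascal m i
      gauss≡pascal = trans (cong (λ z → divPos z (qDen q i)) (sym (pascal*qDen≡qNum m i)))
                           (divPos-*-cancelʳ (pascal m i) (qDen q i) (qDen>0 i))

    *qDen-cancelʳ : ∀ {a b} i → a * qDen q i ≡ b * qDen q i → a ≡ b
    *qDen-cancelʳ {a} {b} i = *-cancelʳ-≡ a b (qDen q i) {{>-nonZero (qDen>0 i)}}

    gauss-suc-upper : ∀ m i → gauss q (suc m) i * ⟦ suc m ∸ i ⟧ ≡ gauss q m i * ⟦ suc m ⟧
    gauss-suc-upper m i = *qDen-cancelʳ i (begin
      gauss q (suc m) i * ⟦ suc m ∸ i ⟧ * qDen q i  ≡⟨ swap₂₃ (gauss q (suc m) i) _ _ ⟩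
      gauss q (suc m) i * qDen q i * ⟦ suc m ∸ i ⟧  ≡⟨ cong (_* ⟦ suc m ∸ i ⟧) (gauss*qDen≡qNum (suc m) i) ⟩
      qNum q (suc m) (suc i)                        ≡⟨ qNum-suc m i ⟩
      ⟦ suc m ⟧ * qNum q m i                        ≡⟨ cong (⟦ suc m ⟧ *_) (gauss*qDen≡qNum m i) ⟨
      ⟦ suc m ⟧ * (gauss q m i * qDen q i)          ≡⟨ swap₁₂ ⟦ suc m ⟧ (gauss q m i) (qDen q i) ⟩
      gauss q m i * ⟦ suc m ⟧ * qDen q i            ∎)
      where
      open ≡-Reasoning
      swap₂₃ : ∀ a b c → a * b * c ≡ a * c * b
      swap₂₃ = solve-∀
      swap₁₂ : ∀ a b c → a * (b * c) ≡ b * a * c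
      swap₁₂ = solve-∀

    gauss-absorption : ∀ m i → gauss q m i * ⟦ suc m ⟧ ≡ gauss q (suc m) (suc i) * ⟦ suc i ⟧
    gauss-absorption m i = *qDen-cancelʳ i (begin
      gauss q m i * ⟦ suc m ⟧ * qDen q i                ≡⟨ swap₁₂ (gauss q m i) ⟦ suc m ⟧ (qDen q i) ⟩
      ⟦ suc m ⟧ * (gauss q m i * qDen q i)              ≡⟨ cong (⟦ suc m ⟧ *_) (gauss*qDen≡qNum m i) ⟩
      ⟦ suc m ⟧ * qNum q m i                            ≡⟨ qNum-suc m i ⟨
      qNum q (suc m) (suc i)                            ≡⟨ gauss*qDen≡qNum (suc m) (suc i) ⟨
      gauss q (suc m) (suc i) * (qDen q i * ⟦ suc i ⟧)  ≡⟨ swap (gauss q (suc m) (suc i)) (qDen q i) ⟦ suc i ⟧ ⟩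
      gauss q (suc m) (suc i) * ⟦ suc i ⟧ * qDen q i    ∎)
      where
      open ≡-Reasoning
      swap₁₂ : ∀ a b c → a * b * c ≡ b * (a * c)
      swap₁₂ = solve-∀
      swap : ∀ a b c → a * (b * c) ≡ a * c * b
      swap = solve-∀

    gauss-1 : ∀ m → gauss q m 1 * ⟦ 1 ⟧ ≡ ⟦ m ⟧
    gauss-1 m = begin
      gauss q m 1 * ⟦ 1 ⟧        ≡⟨ cong (gauss q m 1 *_) (*-identityˡ ⟦ 1 ⟧) ⟨
      gauss q m 1 * qDen q 1     ≡⟨ gauss*qDen≡qNum m 1 ⟩
      qNum q m 1                 ≡⟨ *-identityˡ ⟦ m ⟧ ⟩
      ⟦ m ⟧                      ∎
      where open ≡-Reasoning

    ⟦m⟧≤q^[1+t]*⟦m∸t⟧ : ∀ {m t} → t < m → ⟦ m ⟧ ≤ q ^ suc t * ⟦ m ∸ t ⟧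
    ⟦m⟧≤q^[1+t]*⟦m∸t⟧ {m} {t} t<m = begin
      ⟦ m ⟧                  ≡⟨ cong ⟦_⟧ (m+[n∸m]≡n (<⇒≤ t<m)) ⟨
      ⟦ t + (m ∸ t) ⟧        ≡⟨ ⟦m+n⟧≡⟦m⟧+q^m*⟦n⟧ t (m ∸ t) ⟩
      ⟦ t ⟧ + y              ≤⟨ +-monoˡ-≤ y ⟦t⟧≤y ⟩
      y + y                  ≡⟨ cong (y +_) (+-identityʳ y) ⟨
      2 * y                  ≤⟨ *-monoˡ-≤ y (nonTrivial⇒n>1 q) ⟩
      q * y                  ≡⟨ *-assoc q (q ^ t) ⟦ m ∸ t ⟧ ⟨
      q ^ suc t * ⟦ m ∸ t ⟧  ∎
      where
      open ≤-Reasoning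
      y : ℕ
      y = q ^ t * ⟦ m ∸ t ⟧
      ⟦t⟧≤y : ⟦ t ⟧ ≤ y
      ⟦t⟧≤y = ≤-trans (m∸n≤m (q ^ t) 1) (m≤m*n (q ^ t) ⟦ m ∸ t ⟧ {{>-nonZero (⟦⟧>0 (m<n⇒0<n∸m t<m))}})

    ⟦m⟧*⟦a⟧*⟦b⟧≤⟦m∸t⟧*⟦1⟧*⟦c⟧ : ∀ {m t a b c} → t < m → suc t + a + b ≤ c →
                                ⟦ m ⟧ * ⟦ a ⟧ * ⟦ b ⟧ ≤ ⟦ m ∸ t ⟧ * ⟦ 1 ⟧ * ⟦ c ⟧
    ⟦m⟧*⟦a⟧*⟦b⟧≤⟦m∸t⟧*⟦1⟧*⟦c⟧ {m} {t} {a} {b} {c} t<m 1+t+a+b≤c = begin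
      ⟦ m ⟧ * ⟦ a ⟧ * ⟦ b ⟧
        ≤⟨ *-monoˡ-≤ ⟦ b ⟧ (*-monoˡ-≤ ⟦ a ⟧ (⟦m⟧≤q^[1+t]*⟦m∸t⟧ t<m)) ⟩
      q ^ suc t * ⟦ m ∸ t ⟧ * ⟦ a ⟧ * ⟦ b ⟧
        ≡⟨ regroup (q ^ suc t) ⟦ m ∸ t ⟧ ⟦ a ⟧ ⟦ b ⟧ ⟩
      ⟦ m ∸ t ⟧ * (q ^ suc t * ⟦ a ⟧ * ⟦ b ⟧)
        ≤⟨ *-monoʳ-≤ ⟦ m ∸ t ⟧ q^[1+t]*⟦a⟧*⟦b⟧≤⟦c⟧ ⟩
      ⟦ m ∸ t ⟧ * ⟦ c ⟧
        ≤⟨ m≤m*n (⟦ m ∸ t ⟧ * ⟦ c ⟧) ⟦ 1 ⟧ {{>-nonZero (⟦⟧>0 {1} (s≤s z≤n))}} ⟩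
      ⟦ m ∸ t ⟧ * ⟦ c ⟧ * ⟦ 1 ⟧
        ≡⟨ swap₂₃ ⟦ m ∸ t ⟧ ⟦ c ⟧ ⟦ 1 ⟧ ⟩
      ⟦ m ∸ t ⟧ * ⟦ 1 ⟧ * ⟦ c ⟧ ∎
      where
      open ≤-Reasoning
      q^[1+t]*⟦a⟧*⟦b⟧≤⟦c⟧ : q ^ suc t * ⟦ a ⟧ * ⟦ b ⟧ ≤ ⟦ c ⟧
      q^[1+t]*⟦a⟧*⟦b⟧≤⟦c⟧ = ≤-trans (q^m*⟦n⟧*⟦o⟧≤⟦m+n+o⟧ (suc t) a b) (⟦⟧-mono-≤ 1+t+a+b≤c)
      regroup : ∀ Q d e f → Q * d * e * f ≡ d * (Q * e * f)
      regroup = solve-∀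
      swap₂₃ : ∀ d e f → d * e * f ≡ d * f * e
      swap₂₃ = solve-∀

    gauss-product-suc : ∀ {x t} a M K → t ≤ x →
      gauss q (suc x) t * gauss q a 1 ^ (suc x ∸ t) * gauss q M K * (⟦ suc x ∸ t ⟧ * ⟦ 1 ⟧ * ⟦ suc M ⟧)
        ≡ gauss q x t * gauss q a 1 ^ (x ∸ t) * gauss q (suc M) (suc K) * (⟦ suc x ⟧ * ⟦ a ⟧ * ⟦ suc K ⟧)
    gauss-product-suc {x} {t} a M K t≤x = begin
      B * c ^ (suc x ∸ t) * E * (d * ⟦ 1 ⟧ * ⟦ suc M ⟧)
        ≡⟨ cong (λ e → B * c ^ e * E * (d * ⟦ 1 ⟧ * ⟦ suc M ⟧)) (+-∸-assoc 1 t≤x) ⟩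
      B * (c * P) * E * (d * ⟦ 1 ⟧ * ⟦ suc M ⟧)
        ≡⟨ regroup₁ B c P E d ⟦ 1 ⟧ ⟦ suc M ⟧ ⟩
      B * d * (c * ⟦ 1 ⟧) * P * (E * ⟦ suc M ⟧)
        ≡⟨ cong₂ (λ u v → u * v * P * (E * ⟦ suc M ⟧)) (gauss-suc-upper x t) (gauss-1 a) ⟩
      A * ⟦ suc x ⟧ * ⟦ a ⟧ * P * (E * ⟦ suc M ⟧)
        ≡⟨ cong (A * ⟦ suc x ⟧ * ⟦ a ⟧ * P *_) (gauss-absorption M K) ⟩
      A * ⟦ suc x ⟧ * ⟦ a ⟧ * P * (C * ⟦ suc K ⟧)
        ≡⟨ regroup₂ A ⟦ suc x ⟧ ⟦ a ⟧ P C ⟦ suc K ⟧ ⟩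
      A * P * C * (⟦ suc x ⟧ * ⟦ a ⟧ * ⟦ suc K ⟧) ∎
      where
      open ≡-Reasoning
      A B c P E C d : ℕ
      A = gauss q x t
      B = gauss q (suc x) t
      c = gauss q a 1
      P = c ^ (x ∸ t)
      E = gauss q M K
      C = gauss q (suc M) (suc K)
      d = ⟦ suc x ∸ t ⟧
      regroup₁ : ∀ B c P E d d′ d″ → B * (c * P) * E * (d * d′ * d″) ≡ B * d * (c * d′) * P * (E * d″)
      regroup₁ = solve-∀
      regroup₂ : ∀ A d d′ P C d″ → A * d * d′ * P * (C * d″) ≡ A * P * C * (d * d′ * d″)
      regroup₂ = solve-∀

    gauss-product-suc-≤ : ∀ {x t} a M K → t ≤ x → suc t + a + suc K ≤ suc M →
      gauss q (suc x) t * gauss q a 1 ^ (suc x ∸ t) * gauss q M K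
        ≤ gauss q x t * gauss q a 1 ^ (x ∸ t) * gauss q (suc M) (suc K)
    gauss-product-suc-≤ {x} {t} a M K t≤x bound =
      *-cancelʳ-≤ _ _ (⟦ suc x ∸ t ⟧ * ⟦ 1 ⟧ * ⟦ suc M ⟧) {{>-nonZero denominator>0}}
        (≤-trans (≤-reflexive (gauss-product-suc a M K t≤x))
                 (*-monoʳ-≤ (gauss q x t * gauss q a 1 ^ (x ∸ t) * gauss q (suc M) (suc K))
                             (⟦m⟧*⟦a⟧*⟦b⟧≤⟦m∸t⟧*⟦1⟧*⟦c⟧ (s≤s t≤x) bound)))
      where
      denominator>0 : 0 < ⟦ suc x ∸ t ⟧ * ⟦ 1 ⟧ * ⟦ suc M ⟧
      denominator>0 = *-mono-≤ (*-mono-≤ (⟦⟧>0 (m<n⇒0<n∸m (s≤s t≤x))) (⟦⟧>0 {1} (s≤s z≤n)))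
                               (⟦⟧>0 {suc M} (s≤s z≤n))

    h-suc≤h : ∀ n k t {x} → 2 * k + 2 ≤ n → t ≤ x → x < k → h q n k t (suc x) ≤ h q n k t x
    h-suc≤h n k t {x} 2k+2≤n t≤x x<k = begin
      h q n k t (suc x)
        ≡⟨ h-explicit n k t x<k ⟩
      gauss q (suc x) t * c ^ (suc x ∸ t) * gauss q M K
        ≤⟨ gauss-product-suc-≤ (k ∸ t + 1) M K t≤x bound ⟩
      gauss q x t * c ^ (x ∸ t) * gauss q (suc M) (suc K)
        ≡⟨ cong₂ (λ M′ K′ → gauss q x t * c ^ (x ∸ t) * gauss q M′ K′) n∸x≡1+M k∸x≡1+K ⟨
      gauss q x t * c ^ (x ∸ t) * gauss q (n ∸ x) (k ∸ x)
        ≡⟨ h-explicit n k t (<⇒≤ x<k) ⟨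
      h q n k t x ∎
      where
      open ≤-Reasoning
      c M K : ℕ
      c = gauss q (k ∸ t + 1) 1
      M = n ∸ suc x
      K = k ∸ suc x
      k∸x≡1+K : k ∸ x ≡ suc K
      k∸x≡1+K = m∸n≡1+m∸[1+n] x<k
      n∸x≡1+M : n ∸ x ≡ suc M
      n∸x≡1+M = m∸n≡1+m∸[1+n] (<-≤-trans x<k k≤n)
        where
        k≤n : k ≤ n
        k≤n = ≤-trans (≤-trans (m≤m+n k (k + 0)) (m≤m+n (2 * k) 2)) 2k+2≤n
      1+t+[k∸t+1]≡k+2 : suc t + (k ∸ t + 1) ≡ k + 2
      1+t+[k∸t+1]≡k+2 = trans (shift t (k ∸ t)) (cong (_+ 2) (m+[n∸m]≡n (≤-trans t≤x (<⇒≤ x<k))))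
        where
        shift : ∀ t d → suc t + (d + 1) ≡ t + d + 2
        shift = solve-∀
      double : ∀ k → k + 2 + k ≡ 2 * k + 2
      double = solve-∀
      bound : suc t + (k ∸ t + 1) + suc K ≤ suc M
      bound = begin
        suc t + (k ∸ t + 1) + suc K    ≡⟨ cong₂ _+_ 1+t+[k∸t+1]≡k+2 (sym k∸x≡1+K) ⟩
        k + 2 + (k ∸ x)                ≡⟨ +-∸-assoc (k + 2) (<⇒≤ x<k) ⟨
        k + 2 + k ∸ x                  ≤⟨ ∸-monoˡ-≤ x (≤-trans (≤-reflexive (double k)) 2k+2≤n) ⟩
        n ∸ x                          ≡⟨ n∸x≡1+M ⟩
        suc M                          ∎

    h-antitone : ∀ n k t {x} → 2 * k + 2 ≤ n → t ≤ x → x ≤ k → h q n k t (x + 1) ≤ h q n k t x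
    h-antitone n k t {x} 2k+2≤n t≤x x≤k rewrite +-comm x 1 with m≤n⇒m<n∨m≡n x≤k
    ... | inj₁ x<k  = h-suc≤h n k t 2k+2≤n t≤x x<k
    ... | inj₂ refl = ≤-trans (≤-reflexive (h-vanishes n x t (n<1+n x))) z≤n

lemma2p4 : (q : ℕ) → IsPrimePower q →
           (n k t : ℕ) → 1 ≤ n → 1 ≤ k → 1 ≤ t →
           n ≥ 2 * k + 2 → k ≥ t + 1 →
           (x : ℕ) → t ≤ x → x ≤ k →
           h q n k t x ≥ h q n k t (x + 1)
lemma2p4 q q-primePower n k t _ _ _ 2k+2≤n _ x t≤x x≤k =
  QAnalogue.h-antitone q {{primePower⇒nonTrivial q-primePower}} n k t 2k+2≤n t≤x x≤k
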